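{- Let $\mathfrak{A}$ be a Heyting algebra and $a,b\in|\mathfrak{A}|$. If $a$ is enriched in $\mathfrak{A}$ with $b$, then $b$ is dense, i.e. $\neg b=\mathbf{0}$.
   Context: In a Heyting algebra $\mathfrak{A}$, an element $b$ enriches $a$ if: (a) $a\le b$; (b) $b\rightarrow a=a$; (c) $b\le x\vee(x\rightarrow a)$ for every $x\in|\mathfrak{A}|$. -}

module Defs where

open import Level using (Level)
open import Data.Product using (_×_)
open import Relation.Binary.Lattice.Bundles using (HeytingAlgebra)

Enriches : ∀ {c ℓ₁ ℓ₂} (H : HeytingAlgebra c ℓ₁ ℓ₂) →
           HeytingAlgebra.Carrier H → HeytingAlgebra.Carrier H → Set (c Level.⊔ ℓ₁ Level.⊔ ℓ₂)
Enriches H b a =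
  (a ≤ b) × ((b ⇨ a) ≈ a) × (∀ x → b ≤ (x ∨ (x ⇨ a)))
  where open HeytingAlgebra H

neg : ∀ {c ℓ₁ ℓ₂} (H : HeytingAlgebra c ℓ₁ ℓ₂) →
      HeytingAlgebra.Carrier H → HeytingAlgebra.Carrier H
neg H b = b ⇨ ⊥
  where open HeytingAlgebra H

module Submission where

open import Defs
open import Data.Product using (_,_)
open import Relation.Binary.Lattice.Bundles using (HeytingAlgebra)

-- ¬ b lies below b ⇨ a = a ≤ b, and an element below both b and ¬ b is ⊥.
-- Only conditions (a) and (b) of enrichment are needed.

module _ {c ℓ₁ ℓ₂} (H : HeytingAlgebra c ℓ₁ ℓ₂) where

  open HeytingAlgebra H
  open import Relation.Binary.Lattice.Properties.HeytingAlgebra H using (¬_; ⇨ʳ-covariant; ⇨-eval)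

  ¬x≤x⇨y : ∀ x y → ¬ x ≤ x ⇨ y
  ¬x≤x⇨y x y = ⇨ʳ-covariant (minimum y)

  ¬x≤x⇒¬x≈⊥ : ∀ {x} → ¬ x ≤ x → ¬ x ≈ ⊥
  ¬x≤x⇒¬x≈⊥ {x} ¬x≤x = antisym (trans (∧-greatest refl ¬x≤x) ⇨-eval) (minimum (¬ x))

propositionP : ∀ {c ℓ₁ ℓ₂} (H : HeytingAlgebra c ℓ₁ ℓ₂) (a b : HeytingAlgebra.Carrier H) →
    Enriches H b a → HeytingAlgebra._≈_ H (neg H b) (HeytingAlgebra.⊥ H)
propositionP H a b (a≤b , b⇨a≈a , _) =
  ¬x≤x⇒¬x≈⊥ H (trans (¬x≤x⇨y H b a) (trans (reflexive b⇨a≈a) a≤b))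
  where open HeytingAlgebra H
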